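{- Let $p\geq 3$ be a prime number. Then \[ 2\sum_{\substack{u+v=p\\ 0<u<v}}(-uv)^{p(p-1)/2}\equiv p-1\pmod{p^2}, \] where the sum runs over pairs of positive integers $u<v$ with $u+v=p$. -}

module Defs where

open import Data.Nat as ℕ using (ℕ; zero; suc; _∸_; _<?_)
open import Data.Nat.DivMod using (_/_)
open import Data.Integer as ℤ using (ℤ; +_; -_; _*_; _+_; _^_)
open import Relation.Nullary using (yes; no)

term : ℕ → ℕ → ℤ
term p u = (- (+ u * + (p ∸ u))) ^ ((p ℕ.* (p ∸ 1)) / 2)

sumTo : ℕ → ℕ → ℤ
sumTo p zero = + 0
sumTo p (suc n) with suc n <? p ∸ suc n
... | yes _ = term p (suc n) + sumTo p n
... | no _  = sumTo p n

-- the sum  Σ_{u+v=p, 0<u<v} (-uv)^{p(p-1)/2}; u ranges over 1..p-1 (then v = p-u ≥ 1)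
pairSum : ℕ → ℤ
pairSum p = sumTo p (p ∸ 1)

-- Write p = 1 + 2h. For 0 < u < p and v = p - u we have -uv ≡ u² (mod p), so by Fermat
-- (-uv)^h ≡ u^(p-1) ≡ 1 (mod p); and the p-th power of anything ≡ 1 (mod p) is ≡ 1 (mod p²).
-- As p(p-1)/2 = hp, every term of the sum is ≡ 1 (mod p²). The terms are those with
-- u < p - u, i.e. u = 1, …, h, so the sum is ≡ h and twice it is ≡ 2h = p - 1 (mod p²).
module Submission where

open import Algebra.Bundles using (CommutativeSemiring)
open import Data.Fin as Fin using (Fin; toℕ; fromℕ; inject₁)
open import Data.Fin.Properties using (toℕ-fromℕ; toℕ-inject₁; toℕ<n)
import Data.Integer as ℤ
import Data.Integer.Properties as ℤ
open import Data.Integer.Divisibility using (_∣_)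
import Data.Integer.Divisibility.Signed as Signed
open Signed using (divides; ∣ᵤ⇒∣; ∣⇒∣ᵤ; ∣m∣n⇒∣m+n; ∣m⇒∣-m; ∣m⇒∣m*n; ∣n⇒∣m*n)
open import Data.Integer.Tactic.RingSolver using (solve-∀)
open import Data.Nat as ℕ using (ℕ; zero; suc; _∸_; _⊓_; _≤_; _<_; s≤s; z≤n; _<?_)
import Data.Nat.Properties as ℕ
import Data.Nat.Divisibility as ℕ
open import Data.Nat.Combinatorics using (_C_; nCn≡1; nC1≡n; nCk+nC[k+1]≡[n+1]C[k+1])
open import Data.Nat.DivMod using (_/_; _%_; m*n/n≡m; m≡m%n+[m/n]*n; m%n<n)
open import Data.Nat.Primality using (Prime; euclidsLemma; composite; prime⇒¬composite)
import Data.Nat.Tactic.RingSolver as ℕ-Solver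
open import Data.Product using (∃; _,_)
open import Data.Sum as Sum using (_⊎_; [_,_]′)
open import Data.Vec.Functional using (Vector)
open import Function using (id)
open import Level using (0ℓ)
open import Relation.Binary.Bundles using (Setoid)
open import Relation.Binary.Structures using (IsEquivalence)
open import Relation.Binary.PropositionalEquality
import Relation.Binary.Reasoning.Setoid
open import Relation.Nullary using (¬_; yes; no; contradiction)

open import Defs using (term; sumTo; pairSum)

module _ where
  open import Data.Nat.Base using (_+_; _*_)

  [k+1]*[n+1]C[k+1]≡[n+1]*nCk : ∀ n k → suc k * (suc n C suc k) ≡ suc n * (n C k)
  [k+1]*[n+1]C[k+1]≡[n+1]*nCk zero    zero    = refl
  [k+1]*[n+1]C[k+1]≡[n+1]*nCk zero    (suc k) = ℕ.*-zeroʳ (suc (suc k))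
  [k+1]*[n+1]C[k+1]≡[n+1]*nCk (suc n) zero    =
    trans (ℕ.+-identityʳ _) (trans (nC1≡n (suc (suc n))) (sym (ℕ.*-identityʳ _)))
  [k+1]*[n+1]C[k+1]≡[n+1]*nCk (suc n) (suc k) = begin
    suc (suc k) * (suc (suc n) C suc (suc k))
      ≡⟨ cong (suc (suc k) *_) (sym (nCk+nC[k+1]≡[n+1]C[k+1] (suc n) (suc k))) ⟩
    suc (suc k) * (a + b)
      ≡⟨ split k a b ⟩
    suc k * a + a + suc (suc k) * b
      ≡⟨ cong₂ (λ x y → x + a + y) ([k+1]*[n+1]C[k+1]≡[n+1]*nCk n k)
                                   ([k+1]*[n+1]C[k+1]≡[n+1]*nCk n (suc k)) ⟩
    suc n * (n C k) + a + suc n * (n C suc k)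
      ≡⟨ merge n a (n C k) (n C suc k) ⟩
    suc n * (n C k + n C suc k) + a
      ≡⟨ cong (λ x → suc n * x + a) (nCk+nC[k+1]≡[n+1]C[k+1] n k) ⟩
    suc n * a + a
      ≡⟨ ℕ.+-comm (suc n * a) a ⟩
    suc (suc n) * a
      ∎
    where
    open ≡-Reasoning
    a = suc n C suc k
    b = suc n C suc (suc k)
    split : ∀ k a b → suc (suc k) * (a + b) ≡ suc k * a + a + suc (suc k) * b
    split = ℕ-Solver.solve-∀
    merge : ∀ n a c d → suc n * c + a + suc n * d ≡ suc n * (c + d) + a
    merge = ℕ-Solver.solve-∀

  prime∣pCk : ∀ {p k} → Prime p → 0 < k → k < p → p ℕ.∣ p C k
  prime∣pCk {suc n} {suc k} p-prime _ k<p =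
    [ (λ p∣k+1 → contradiction (ℕ.∣⇒≤ p∣k+1) (ℕ.<⇒≱ k<p)) , id ]′
      (euclidsLemma (suc k) (suc n C suc k) p-prime
        (ℕ.divides (n C k) (trans ([k+1]*[n+1]C[k+1]≡[n+1]*nCk n k) (ℕ.*-comm (suc n) (n C k)))))

open import Data.Integer.Base using (ℤ; +_; -_; _+_; _-_; _*_; _^_; 0ℤ; 1ℤ)

infix 4 _≡_[mod_]

-- A record rather than a synonym for m ∣ a - b, so that a, b and m stay inferable.
record _≡_[mod_] (a b m : ℤ) : Set where
  constructor congruent
  field divides-difference : m Signed.∣ a - b

open _≡_[mod_]

module _ {m : ℤ} where

  mod-reflexive : ∀ {a b} → a ≡ b → a ≡ b [mod m ]
  mod-reflexive {a} refl = congruent (divides 0ℤ (ℤ.+-inverseʳ a))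

  mod-sym : ∀ {a b} → a ≡ b [mod m ] → b ≡ a [mod m ]
  mod-sym {a} {b} (congruent m∣a-b) = congruent (subst (m Signed.∣_) (negate a b) (∣m⇒∣-m m∣a-b))
    where
    negate : ∀ a b → - (a - b) ≡ b - a
    negate = solve-∀

  mod-trans : ∀ {a b c} → a ≡ b [mod m ] → b ≡ c [mod m ] → a ≡ c [mod m ]
  mod-trans {a} {b} {c} (congruent m∣a-b) (congruent m∣b-c) =
    congruent (subst (m Signed.∣_) (telescope a b c) (∣m∣n⇒∣m+n m∣a-b m∣b-c))
    where
    telescope : ∀ a b c → (a - b) + (b - c) ≡ a - c
    telescope = solve-∀

  +-cong-mod : ∀ {a b c d} → a ≡ b [mod m ] → c ≡ d [mod m ] → a + c ≡ b + d [mod m ]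
  +-cong-mod {a} {b} {c} {d} (congruent m∣a-b) (congruent m∣c-d) =
    congruent (subst (m Signed.∣_) (split a b c d) (∣m∣n⇒∣m+n m∣a-b m∣c-d))
    where
    split : ∀ a b c d → (a - b) + (c - d) ≡ (a + c) - (b + d)
    split = solve-∀

  *-cong-mod : ∀ {a b c d} → a ≡ b [mod m ] → c ≡ d [mod m ] → a * c ≡ b * d [mod m ]
  *-cong-mod {a} {b} {c} {d} (congruent m∣a-b) (congruent m∣c-d) =
    congruent (subst (m Signed.∣_) (split a b c d) (∣m∣n⇒∣m+n (∣m⇒∣m*n c m∣a-b) (∣n⇒∣m*n b m∣c-d)))
    where
    split : ∀ a b c d → (a - b) * c + b * (c - d) ≡ a * c - b * d
    split = solve-∀

  *-congˡ-mod : ∀ a {c d} → c ≡ d [mod m ] → a * c ≡ a * d [mod m ]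
  *-congˡ-mod a = *-cong-mod (mod-reflexive {a = a} refl)

  ^-cong-mod : ∀ {a b} n → a ≡ b [mod m ] → a ^ n ≡ b ^ n [mod m ]
  ^-cong-mod zero    _   = mod-reflexive refl
  ^-cong-mod (suc n) a≡b = *-cong-mod a≡b (^-cong-mod n a≡b)

  +-multiple-mod : ∀ a k → a + k * m ≡ a [mod m ]
  +-multiple-mod a k = congruent (divides k (cancel a k m))
    where
    cancel : ∀ a k m → a + k * m - a ≡ k * m
    cancel = solve-∀

  mod-isEquivalence : IsEquivalence (λ a b → a ≡ b [mod m ])
  mod-isEquivalence = record { refl = mod-reflexive refl ; sym = mod-sym ; trans = mod-trans }

mod-setoid : ℤ → Setoid 0ℓ 0ℓ
mod-setoid m = record { isEquivalence = mod-isEquivalence {m} }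

module ModReasoning (m : ℤ) = Relation.Binary.Reasoning.Setoid (mod-setoid m)

1+km^n≡1+nkm : ∀ k m n → (1ℤ + k * m) ^ n ≡ 1ℤ + + n * k * m [mod m * m ]
1+km^n≡1+nkm k m zero    = mod-reflexive refl
1+km^n≡1+nkm k m (suc n) = begin
  (1ℤ + k * m) * (1ℤ + k * m) ^ n                   ≈⟨ *-congˡ-mod (1ℤ + k * m) (1+km^n≡1+nkm k m n) ⟩
  (1ℤ + k * m) * (1ℤ + + n * k * m)                 ≡⟨ expand k m (+ n) ⟩
  1ℤ + (1ℤ + + n) * k * m + (+ n * k * k) * (m * m) ≈⟨ +-multiple-mod _ (+ n * k * k) ⟩
  1ℤ + + suc n * k * m                              ∎
  where
  open ModReasoning (m * m)
  expand : ∀ k m n → (1ℤ + k * m) * (1ℤ + n * k * m) ≡ 1ℤ + (1ℤ + n) * k * m + (n * k * k) * (m * m)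
  expand = solve-∀

^-lift : ∀ {a} n → a ≡ 1ℤ [mod + n ] → a ^ n ≡ 1ℤ [mod + n * + n ]
^-lift {a} n (congruent (divides k a-1≡kn)) = begin
  a ^ n                    ≡⟨ cong (_^ n) (a≡1+kn a-1≡kn) ⟩
  (1ℤ + k * + n) ^ n       ≈⟨ 1+km^n≡1+nkm k (+ n) n ⟩
  1ℤ + + n * k * + n       ≡⟨ regroup (+ n) k ⟩
  1ℤ + k * (+ n * + n)     ≈⟨ +-multiple-mod 1ℤ k ⟩
  1ℤ                       ∎
  where
  open ModReasoning (+ n * + n)
  a≡1+kn : a - 1ℤ ≡ k * + n → a ≡ 1ℤ + k * + n
  a≡1+kn eq = trans (solve a) (cong (λ x → 1ℤ + x) eq)
    where solve : ∀ a → a ≡ 1ℤ + (a - 1ℤ)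
          solve = solve-∀
  regroup : ∀ n k → 1ℤ + n * k * n ≡ 1ℤ + k * (n * n)
  regroup = solve-∀

private
  module ℤ-Semiring = CommutativeSemiring ℤ.+-*-commutativeSemiring

open import Algebra.Properties.CommutativeSemiring.Binomial ℤ.+-*-commutativeSemiring
  using (theorem; binomialTerm)
open import Algebra.Properties.Semiring.Sum ℤ-Semiring.semiring using (sum; sum-init-last)
open import Algebra.Properties.Semiring.Mult ℤ-Semiring.semiring using (_×_)
open import Algebra.Properties.Semiring.Exp ℤ-Semiring.semiring using () renaming (_^_ to _^ₛ_)

×≡pos* : ∀ n x → n × x ≡ + n * x
×≡pos* zero    x = refl
×≡pos* (suc n) x = trans (cong (ℤ._+_ x) (×≡pos* n x)) (sym (ℤ.suc-* (+ n) x))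

^ₛ≡^ : ∀ x n → x ^ₛ n ≡ x ^ n
^ₛ≡^ x zero    = refl
^ₛ≡^ x (suc n) = cong (x *_) (^ₛ≡^ x n)

∣-sum : ∀ {d n} (f : Vector ℤ n) → (∀ i → d Signed.∣ f i) → d Signed.∣ sum f
∣-sum {n = zero}  f d∣f = divides 0ℤ refl
∣-sum {n = suc n} f d∣f = ∣m∣n⇒∣m+n (d∣f Fin.zero) (∣-sum (λ i → f (Fin.suc i)) (λ i → d∣f (Fin.suc i)))

freshman's-dream : ∀ {p} → Prime p → ∀ x y → (x + y) ^ p ≡ x ^ p + y ^ p [mod + p ]
freshman's-dream {suc q} p-prime x y =
  congruent (subst (+ p Signed.∣_) (sym expansion-middle) (∣-sum middle p∣middle))
  where
  p = suc q
  t : Fin (suc p) → ℤ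
  t = binomialTerm x y p
  middle : Vector ℤ q
  middle i = t (Fin.suc (inject₁ i))

  p∣middle : ∀ i → + p Signed.∣ middle i
  p∣middle i = subst (+ p Signed.∣_) (sym (×≡pos* (p C k) _))
    (∣m⇒∣m*n {m = + (p C k)} _ (∣ᵤ⇒∣ (prime∣pCk p-prime (s≤s z≤n) k<p)))
    where
    k = suc (toℕ (inject₁ i))
    k<p : k ℕ.< p
    k<p = s≤s (subst (ℕ._< q) (sym (toℕ-inject₁ i)) (toℕ<n i))

  first : t Fin.zero ≡ y ^ p
  first = trans (ℤ.+-identityʳ _) (trans (ℤ.*-identityˡ _) (^ₛ≡^ y p))

  last : t (Fin.suc (fromℕ q)) ≡ x ^ p
  last rewrite toℕ-fromℕ q | nCn≡1 p | ℕ.n∸n≡0 q =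
    trans (ℤ.+-identityʳ _) (trans (ℤ.*-identityʳ _) (^ₛ≡^ x p))

  expansion : (x + y) ^ p ≡ y ^ p + (sum middle + x ^ p)
  expansion = begin
    (x + y) ^ p                                   ≡⟨ sym (^ₛ≡^ (x + y) p) ⟩
    (x + y) ^ₛ p                                  ≡⟨ theorem p x y ⟩
    t Fin.zero + sum (λ i → t (Fin.suc i))        ≡⟨ cong₂ _+_ first (sum-init-last (λ i → t (Fin.suc i))) ⟩
    y ^ p + (sum middle + t (Fin.suc (fromℕ q)))  ≡⟨ cong (λ z → y ^ p + (sum middle + z)) last ⟩
    y ^ p + (sum middle + x ^ p)                  ∎
    where open ≡-Reasoning

  expansion-middle : (x + y) ^ p - (x ^ p + y ^ p) ≡ sum middle
  expansion-middle = trans (cong (_- (x ^ p + y ^ p)) expansion) (cancel (y ^ p) (sum middle) (x ^ p))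
    where
    cancel : ∀ a b c → a + (b + c) - (c + a) ≡ b
    cancel = solve-∀

fermat : ∀ {p} → Prime p → ∀ a → (+ a) ^ p ≡ + a [mod + p ]
fermat {suc q} p-prime zero    = mod-reflexive refl
fermat {p}     p-prime (suc a) = begin
  (1ℤ + + a) ^ p       ≈⟨ freshman's-dream p-prime 1ℤ (+ a) ⟩
  1ℤ ^ p + (+ a) ^ p   ≈⟨ +-cong-mod (mod-reflexive (ℤ.^-zeroˡ p)) (fermat p-prime a) ⟩
  1ℤ + + a             ∎
  where open ModReasoning (+ p)

prime∣*⇒∣⊎∣ : ∀ {p} → Prime p → ∀ {i j} → + p Signed.∣ i * j → (+ p Signed.∣ i) ⊎ (+ p Signed.∣ j)
prime∣*⇒∣⊎∣ p-prime {i} {j} p∣ij =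
  Sum.map ∣ᵤ⇒∣ ∣ᵤ⇒∣ (euclidsLemma ℤ.∣ i ∣ ℤ.∣ j ∣ p-prime (subst (_ ℕ.∣_) (ℤ.abs-* i j) (∣⇒∣ᵤ p∣ij)))

fermat-little : ∀ {p a} → Prime p → ¬ p ℕ.∣ a → (+ a) ^ (p ∸ 1) ≡ 1ℤ [mod + p ]
fermat-little {suc q} {a} p-prime p∤a =
  congruent ([ (λ p∣a → contradiction (∣⇒∣ᵤ p∣a) p∤a) , id ]′ (prime∣*⇒∣⊎∣ p-prime {+ a} p∣a[a^q-1]))
  where
  factor : ∀ a b → a * b - a ≡ a * (b - 1ℤ)
  factor = solve-∀
  p∣a[a^q-1] : + suc q Signed.∣ + a * ((+ a) ^ q - 1ℤ)
  p∣a[a^q-1] = subst (+ suc q Signed.∣_) (factor (+ a) ((+ a) ^ q)) (divides-difference (fermat p-prime a))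

odd-prime : ∀ {p} → Prime p → 3 ≤ p → ∃ λ h → p ≡ suc (h ℕ.+ h)
odd-prime {p} p-prime 3≤p with p % 2 | m≡m%n+[m/n]*n p 2 | m%n<n p 2
... | 0           | p≡[p/2]*2   | _ =
  contradiction (composite {2} 3≤p (ℕ.divides (p / 2) p≡[p/2]*2)) (prime⇒¬composite p-prime)
... | 1           | p≡1+[p/2]*2 | _ = p / 2 , trans p≡1+[p/2]*2 (cong suc (double (p / 2)))
  where
  double : ∀ h → h ℕ.* 2 ≡ h ℕ.+ h
  double = ℕ-Solver.solve-∀
... | suc (suc _) | _           | s≤s (s≤s ())

m<n∸m⇒m+m<n : ∀ {m n} → m < n ∸ m → m ℕ.+ m < n
m<n∸m⇒m+m<n {m} {n} m<n∸m = ℕ.m≤o∸n⇒m+n≤o (suc m) m≤n m<n∸m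
  where
  m≤n : m ≤ n
  m≤n = ℕ.<⇒≤ (ℕ.<-≤-trans m<n∸m (ℕ.m∸n≤m n m))

m+m<n⇒m<n∸m : ∀ {m n} → m ℕ.+ m < n → m < n ∸ m
m+m<n⇒m<n∸m {m} = ℕ.m+n≤o⇒m≤o∸n (suc m)

m+m≤n+n⇒m≤n : ∀ {m n} → m ℕ.+ m ≤ n ℕ.+ n → m ≤ n
m+m≤n+n⇒m≤n m+m≤n+n = ℕ.≮⇒≥ (λ n<m → ℕ.<⇒≱ (ℕ.+-mono-< n<m n<m) m+m≤n+n)

square-^ : ∀ x n → (x * x) ^ n ≡ x ^ (n ℕ.+ n)
square-^ x n = begin
  (x * x) ^ n         ≡⟨ cong (λ y → (x * y) ^ n) (sym (ℤ.*-identityʳ x)) ⟩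
  (x ^ 2) ^ n         ≡⟨ ℤ.^-*-assoc x 2 n ⟩
  x ^ (n ℕ.+ (n ℕ.+ 0)) ≡⟨ cong (λ k → x ^ (n ℕ.+ k)) (ℕ.+-identityʳ n) ⟩
  x ^ (n ℕ.+ n)       ∎
  where open ≡-Reasoning

neg-product≡square : ∀ {p u} → u ≤ p → - (+ u * + (p ∸ u)) ≡ + u * + u [mod + p ]
neg-product≡square {p} {u} u≤p = congruent (divides (- + u) (begin
  - (+ u * + (p ∸ u)) - + u * + u   ≡⟨ factor (+ u) (+ (p ∸ u)) ⟩
  - + u * (+ u + + (p ∸ u))         ≡⟨ cong (λ z → - + u * z) (sym p≡u+[p∸u]) ⟩
  - + u * + p                       ∎))
  where
  open ≡-Reasoning
  factor : ∀ u v → - (u * v) - u * u ≡ - u * (u + v)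
  factor = solve-∀
  p≡u+[p∸u] : + p ≡ + u + + (p ∸ u)
  p≡u+[p∸u] = trans (cong +_ (sym (ℕ.m+[n∸m]≡n u≤p))) (ℤ.pos-+ u (p ∸ u))

≤h⇒<[1+h+h]∸ : ∀ {h u} → u ≤ h → u < suc (h ℕ.+ h) ∸ u
≤h⇒<[1+h+h]∸ u≤h = m+m<n⇒m<n∸m (s≤s (ℕ.+-mono-≤ u≤h u≤h))

<[1+h+h]∸⇒≤h : ∀ {h u} → u < suc (h ℕ.+ h) ∸ u → u ≤ h
<[1+h+h]∸⇒≤h u<p∸u = m+m≤n+n⇒m≤n (ℕ.≤-pred (m<n∸m⇒m+m<n u<p∸u))

[1+h+h]*[h+h]/2≡h*[1+h+h] : ∀ h → (suc (h ℕ.+ h) ℕ.* (h ℕ.+ h)) / 2 ≡ h ℕ.* suc (h ℕ.+ h)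
[1+h+h]*[h+h]/2≡h*[1+h+h] h = trans (cong (_/ 2) (regroup h)) (m*n/n≡m (h ℕ.* suc (h ℕ.+ h)) 2)
  where
  regroup : ∀ h → suc (h ℕ.+ h) ℕ.* (h ℕ.+ h) ≡ h ℕ.* suc (h ℕ.+ h) ℕ.* 2
  regroup = ℕ-Solver.solve-∀

module _ {h : ℕ} (p-prime : Prime (suc (h ℕ.+ h))) where

  private
    p = suc (h ℕ.+ h)

  neg-product^h≡1 : ∀ {u} → 0 < u → u < p → (- (+ u * + (p ∸ u))) ^ h ≡ 1ℤ [mod + p ]
  neg-product^h≡1 {u} 0<u u<p = begin
    (- (+ u * + (p ∸ u))) ^ h   ≈⟨ ^-cong-mod h (neg-product≡square (ℕ.<⇒≤ u<p)) ⟩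
    (+ u * + u) ^ h             ≡⟨ square-^ (+ u) h ⟩
    (+ u) ^ (p ∸ 1)             ≈⟨ fermat-little p-prime (ℕ.>⇒∤ {{ℕ.>-nonZero 0<u}} u<p) ⟩
    1ℤ                          ∎
    where open ModReasoning (+ p)

  term≡1 : ∀ {u} → 0 < u → u < p → term p u ≡ 1ℤ [mod + p * + p ]
  term≡1 {u} 0<u u<p = begin
    x ^ ((p ℕ.* (p ∸ 1)) / 2)   ≡⟨ cong (x ^_) ([1+h+h]*[h+h]/2≡h*[1+h+h] h) ⟩
    x ^ (h ℕ.* p)               ≡⟨ sym (ℤ.^-*-assoc x h p) ⟩
    (x ^ h) ^ p                 ≈⟨ ^-lift p (neg-product^h≡1 0<u u<p) ⟩
    1ℤ                          ∎
    where
    open ModReasoning (+ p * + p)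
    x = - (+ u * + (p ∸ u))

  sumTo≡⊓ : ∀ n → sumTo p n ≡ + (n ⊓ h) [mod + p * + p ]
  sumTo≡⊓ zero = mod-reflexive refl
  sumTo≡⊓ (suc n) with suc n <? p ∸ suc n
  ... | yes n+1<p∸[n+1] = begin
    term p (suc n) + sumTo p n  ≈⟨ +-cong-mod (term≡1 (s≤s z≤n) n+1<p) (sumTo≡⊓ n) ⟩
    1ℤ + + (n ⊓ h)              ≡⟨ cong +_ 1+n⊓h≡[n+1]⊓h ⟩
    + (suc n ⊓ h)               ∎
    where
    open ModReasoning (+ p * + p)
    n+1≤h : suc n ≤ h
    n+1≤h = <[1+h+h]∸⇒≤h n+1<p∸[n+1]
    n+1<p : suc n < p
    n+1<p = s≤s (ℕ.m≤n⇒m≤n+o h n+1≤h)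
    1+n⊓h≡[n+1]⊓h : suc (n ⊓ h) ≡ suc n ⊓ h
    1+n⊓h≡[n+1]⊓h = trans (cong suc (ℕ.m≤n⇒m⊓n≡m (ℕ.<⇒≤ n+1≤h))) (sym (ℕ.m≤n⇒m⊓n≡m n+1≤h))
  ... | no ¬n+1<p∸[n+1] = subst (λ k → sumTo p n ≡ + k [mod + p * + p ]) n⊓h≡[n+1]⊓h (sumTo≡⊓ n)
    where
    h≤n : h ≤ n
    h≤n = ℕ.≤-pred (ℕ.≰⇒> (λ n+1≤h → ¬n+1<p∸[n+1] (≤h⇒<[1+h+h]∸ n+1≤h)))
    n⊓h≡[n+1]⊓h : n ⊓ h ≡ suc n ⊓ h
    n⊓h≡[n+1]⊓h = trans (ℕ.m≥n⇒m⊓n≡n h≤n) (sym (ℕ.m≥n⇒m⊓n≡n (ℕ.m≤n⇒m≤1+n h≤n)))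

  twice-pairSum≡p-1 : + 2 * pairSum p ≡ + (p ∸ 1) [mod + p * + p ]
  twice-pairSum≡p-1 = begin
    + 2 * pairSum p             ≈⟨ *-congˡ-mod (+ 2) (sumTo≡⊓ (h ℕ.+ h)) ⟩
    + 2 * + ((h ℕ.+ h) ⊓ h)     ≡⟨ cong (λ k → + 2 * + k) (ℕ.m≥n⇒m⊓n≡n (ℕ.m≤m+n h h)) ⟩
    + 2 * + h                   ≡⟨ trans (double (+ h)) (sym (ℤ.pos-+ h h)) ⟩
    + (h ℕ.+ h)                 ∎
    where
    open ModReasoning (+ p * + p)
    double : ∀ x → + 2 * x ≡ x + x
    double = solve-∀

corollary2p14 : (p : ℕ) → Prime p → 3 ≤ p →
    (+ (p ℕ.* p)) ∣ ((+ 2 * pairSum p) - + (p ℕ.∸ 1))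
corollary2p14 p p-prime 3≤p with odd-prime p-prime 3≤p
... | h , refl = ∣⇒∣ᵤ (subst (Signed._∣ (+ 2 * pairSum p - + (p ∸ 1))) (sym (ℤ.pos-* p p))
                             (divides-difference (twice-pairSum≡p-1 {h} p-prime)))
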